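{- Let ${\mathcal H}$ be a $k$-uniform simple intersecting hypergraph with $r$ edges and maximum degree two. Then for each $1\le m\le r/2$, the number of independent sets of vertices of degree two of size $m$ in ${\mathcal H}$ equals \[\frac{r!}{(r-2m)!\,m!\,2^m}.\]
   Context: A hypergraph is simple if any two distinct edges share at most one vertex; it is intersecting if any two edges share at least one vertex. An independent set of vertices of degree two is a set $S$ of vertices each of degree exactly two such that no edge contains more than one element of $S$. -}

module Defs where

open import Data.Nat using (ℕ; zero; suc; _+_; _*_; _∸_; _^_; _≤_; _/_; NonZero; _!)
open import Data.Nat.Properties using (_≟_; _≤?_; _!≢0; m*n≢0; m^n≢0)

open import Data.Fin using (Fin)
open import Data.Fin.Subset using (Subset; _∈_; _∩_; ∣_∣; Nonempty; inside; outside)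
open import Data.Fin.Subset.Properties using (_∈?_)
open import Data.Fin.Properties using (all?)
open import Data.Vec using ([]; _∷_; count; allFin)
open import Data.List using (List; [_]; map; _++_; filter; length)
open import Relation.Binary.PropositionalEquality using (_≡_; _≢_)
open import Relation.Nullary using (Dec; _×-dec_; _→-dec_)
open import Data.Product using (_×_)
open import Function using (Injective)

Hypergraph : ℕ → ℕ → Set
Hypergraph n r = Fin r → Subset n

module _ {n r : ℕ} (E : Hypergraph n r) where

  DistinctEdges : Set
  DistinctEdges = Injective _≡_ _≡_ E

  degree : Fin n → ℕ
  degree v = count (λ i → v ∈? E i) (allFin r)

  Uniform : ℕ → Set
  Uniform k = ∀ i → ∣ E i ∣ ≡ k

  Simple : Set
  Simple = ∀ i j → i ≢ j → ∣ E i ∩ E j ∣ ≤ 1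

  Intersecting : Set
  Intersecting = ∀ i j → i ≢ j → Nonempty (E i ∩ E j)

  MaxDegree≤ : ℕ → Set
  MaxDegree≤ d = ∀ v → degree v ≤ d

  IsIndepDeg2 : ℕ → Subset n → Set
  IsIndepDeg2 m S =
    (∣ S ∣ ≡ m) × ((∀ v → v ∈ S → degree v ≡ 2) × (∀ i → ∣ S ∩ E i ∣ ≤ 1))

  isIndepDeg2? : ∀ m S → Dec (IsIndepDeg2 m S)
  isIndepDeg2? m S =
    (∣ S ∣ ≟ m) ×-dec
      (all? (λ v → (v ∈? S) →-dec (degree v ≟ 2)) ×-dec
       all? (λ i → ∣ S ∩ E i ∣ ≤? 1))

allSubsets : ∀ n → List (Subset n)
allSubsets zero = [ [] ]
allSubsets (suc n) = map (outside ∷_) (allSubsets n) ++ map (inside ∷_) (allSubsets n)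

numIndepDeg2 : ∀ {n r} → Hypergraph n r → ℕ → ℕ
numIndepDeg2 {n} E m = length (filter (isIndepDeg2? E m) (allSubsets n))

formula : ℕ → ℕ → ℕ
formula r m = (r !) / (((r ∸ 2 * m) ! * m !) * 2 ^ m)
  where
  instance
    _ = m*n≢0 ((r ∸ 2 * m) !) (m !) {{(r ∸ 2 * m) !≢0}} {{m !≢0}}
    _ = m^n≢0 2 m
    _ = m*n≢0 ((r ∸ 2 * m) ! * m !) (2 ^ m)

-- Record each vertex by its column, the set of edges through it. In a simple intersecting
-- hypergraph any two distinct edges share exactly one vertex, and that vertex has degree two;
-- with maximum degree two, the columns of size two are therefore exactly the pairs of edges,
-- each occurring once. An independent set of degree-two vertices is thus a set of pairwise
-- disjoint pairs of edges: a matching of the complete graph on the r edges.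
--
-- These matchings are counted on the columns themselves. Consider more generally matchings
-- avoiding a set F of edges and fix an edge e outside F: a matching either leaves e unmatched
-- or contains one of the columns joining e to the other free edges, one for each of them.
-- With s + 2 free edges this gives M (s + 2) (m + 1) = M (s + 1) (m + 1) + (s + 1) M s m,
-- using only that every column has at most two edges and every pair of edges lies in exactly
-- one column, and the recursion is solved by s! / ((s - 2m)! m! 2^m).

module Submission where

open import Defs
open import Data.Nat using (ℕ; _≤_; _*_)
open import Relation.Binary.PropositionalEquality using (_≡_)

open import Data.Bool.Base using (Bool; true; false; _∧_; _∨_; not; T)
open import Data.Bool.Properties using (∧-comm; ∧-assoc; ∧-zeroʳ)
open import Data.Fin.Base using (Fin; zero; suc; punchIn)
open import Data.Fin.Properties using (punchInᵢ≢i; all?)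
open import Data.Fin.Subset using (Subset; _∈_; _∩_; _∪_; ∁; ∣_∣; inside; outside; ⁅_⁆; ⊥)
open import Data.Fin.Subset.Properties
  using (_∈?_; ∣⁅x⁆∣≡1; ∣⊥∣≡0; ∣∁p∣≡n∸∣p∣; ∪-assoc; ∪-comm; p⊆q⇒∣p∣≤∣q∣; x∈⁅y⁆⇒x≡y)
open import Data.List.Base using ([]; _∷_; map; _++_; filter; length)
open import Data.List.Properties using (filter-≐; filter-none; filter-accept; filter-++; length-++)
open import Data.List.Relation.Unary.All using (universal)
open import Data.Nat.Base using (zero; suc; _+_; _∸_; _<_; z≤n; s≤s; _≡ᵇ_; _!; _^_; _/_; NonZero)
open import Data.Nat.DivMod using (m*n/n≡m)
open import Data.Nat.Properties
open import Algebra.Properties.Semiring.Sum +-*-semiring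
  using (sum; sum-syntax; sum-cong-≗; sum-replicate-zero; ∑-distrib-+; ∑-comm; sum-remove;
         *-distribˡ-sum; *-distribʳ-sum)
open import Data.Nat.Tactic.RingSolver using (solve-∀)
open import Data.Product using (_×_; _,_; proj₁; proj₂; ∃)
open import Data.Vec.Base using ([]; _∷_; lookup; tabulate; count; head; tail; here; there)
open import Data.Vec.Properties
  using (lookup∘tabulate; lookup-zipWith; lookup-map; lookup-replicate; tabulate-cong; lookup⇒[]=)
open import Function.Base using (_∘_)
open import Function.Bundles using (_⇔_; mk⇔; Equivalence)
open import Relation.Binary.PropositionalEquality
  using (refl; sym; trans; cong; cong₂; subst; _≢_; module ≡-Reasoning)
open import Relation.Nullary using (¬_; does; _×-dec_; _→-dec_; contradiction)
open import Relation.Unary using (Pred; Decidable; _≐_)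

⟦_⟧ : Bool → ℕ
⟦ true  ⟧ = 1
⟦ false ⟧ = 0

⟦∧⟧≡⟦⟧*⟦⟧ : ∀ a b → ⟦ a ∧ b ⟧ ≡ ⟦ a ⟧ * ⟦ b ⟧
⟦∧⟧≡⟦⟧*⟦⟧ true  b = sym (+-identityʳ ⟦ b ⟧)
⟦∧⟧≡⟦⟧*⟦⟧ false b = refl

⟦⟧*-∧ : ∀ a b x → ⟦ a ∧ b ⟧ * x ≡ ⟦ a ⟧ * (⟦ b ⟧ * x)
⟦⟧*-∧ a b x = trans (cong (_* x) (⟦∧⟧≡⟦⟧*⟦⟧ a b)) (*-assoc ⟦ a ⟧ ⟦ b ⟧ x)

⟦a⟧*⟦b∧c⟧≡⟦a∧b⟧*⟦c⟧ : ∀ a b c → ⟦ a ⟧ * ⟦ b ∧ c ⟧ ≡ ⟦ a ∧ b ⟧ * ⟦ c ⟧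
⟦a⟧*⟦b∧c⟧≡⟦a∧b⟧*⟦c⟧ a b c rewrite ⟦∧⟧≡⟦⟧*⟦⟧ a b | ⟦∧⟧≡⟦⟧*⟦⟧ b c = sym (*-assoc ⟦ a ⟧ ⟦ b ⟧ ⟦ c ⟧)

∑-zero : ∀ {n} {f : Fin n → ℕ} → (∀ i → f i ≡ 0) → ∑[ i < n ] f i ≡ 0
∑-zero {n} f≡0 = trans (sum-cong-≗ f≡0) (sum-replicate-zero n)

∑-exchange : ∀ {n} (f g : Fin n → ℕ) e → (∀ j → j ≢ e → f j ≡ g j) →
             ∑[ j < n ] f j + g e ≡ ∑[ j < n ] g j + f e
∑-exchange {suc n} f g e f≡g = begin
  sum f + g e                                ≡⟨ cong (_+ g e) (sum-remove {i = e} f) ⟩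
  f e + sum (λ j → f (punchIn e j)) + g e    ≡⟨ cong (λ x → f e + x + g e) rest≡ ⟩
  f e + sum (λ j → g (punchIn e j)) + g e    ≡⟨ swap (f e) _ (g e) ⟩
  g e + sum (λ j → g (punchIn e j)) + f e    ≡⟨ cong (_+ f e) (sum-remove {i = e} g) ⟨
  sum g + f e                                ∎
  where
  open ≡-Reasoning
  rest≡ : sum (λ j → f (punchIn e j)) ≡ sum (λ j → g (punchIn e j))
  rest≡ = sum-cong-≗ (λ j → f≡g (punchIn e j) (punchInᵢ≢i e j))
  swap : ∀ a x b → a + x + b ≡ b + x + a
  swap = solve-∀

count-tabulate : ∀ {a p} {A : Set a} {P : Pred A p} (P? : Decidable P) {n} (f : Fin n → A) →
                 count P? (tabulate f) ≡ ∑[ i < n ] ⟦ does (P? (f i)) ⟧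
count-tabulate P? {zero}  f = refl
count-tabulate P? {suc n} f with does (P? (f zero))
... | true  = cong suc (count-tabulate P? (f ∘ suc))
... | false = count-tabulate P? (f ∘ suc)

length-filter-map : ∀ {a b p} {A : Set a} {B : Set b} {P : Pred B p} (P? : Decidable P) (f : A → B) xs →
                    length (filter P? (map f xs)) ≡ length (filter (P? ∘ f) xs)
length-filter-map P? f []       = refl
length-filter-map P? f (x ∷ xs) with does (P? (f x))
... | true  = cong suc (length-filter-map P? f xs)
... | false = length-filter-map P? f xs

length-filter-++ : ∀ {a p} {A : Set a} {P : Pred A p} (P? : Decidable P) xs ys →
                   length (filter P? (xs ++ ys)) ≡ length (filter P? xs) + length (filter P? ys)
length-filter-++ P? xs ys = trans (cong length (filter-++ P? xs ys)) (length-++ (filter P? xs))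

∣x∷p∣≡⟦x⟧+∣p∣ : ∀ {n} x (p : Subset n) → ∣ x ∷ p ∣ ≡ ⟦ x ⟧ + ∣ p ∣
∣x∷p∣≡⟦x⟧+∣p∣ true  p = refl
∣x∷p∣≡⟦x⟧+∣p∣ false p = refl

∣x∷p∩q∣ : ∀ {n} x (p : Subset n) q → ∣ (x ∷ p) ∩ q ∣ ≡ ⟦ x ∧ head q ⟧ + ∣ p ∩ tail q ∣
∣x∷p∩q∣ x p (y ∷ q) = ∣x∷p∣≡⟦x⟧+∣p∣ (x ∧ y) (p ∩ q)

∣p∣≡∑ : ∀ {n} (p : Subset n) → ∣ p ∣ ≡ ∑[ i < n ] ⟦ lookup p i ⟧
∣p∣≡∑ []      = refl
∣p∣≡∑ (x ∷ p) = trans (∣x∷p∣≡⟦x⟧+∣p∣ x p) (cong (⟦ x ⟧ +_) (∣p∣≡∑ p))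

∣∁p∣≡∑ : ∀ {n} (p : Subset n) → ∣ ∁ p ∣ ≡ ∑[ i < n ] ⟦ not (lookup p i) ⟧
∣∁p∣≡∑ p = trans (∣p∣≡∑ (∁ p)) (sum-cong-≗ (λ i → cong ⟦_⟧ (lookup-map i not p)))

∣p∩∁q∣≡∑ : ∀ {n} (p q : Subset n) → ∣ p ∩ ∁ q ∣ ≡ ∑[ i < n ] ⟦ lookup p i ∧ not (lookup q i) ⟧
∣p∩∁q∣≡∑ p q = trans (∣p∣≡∑ (p ∩ ∁ q)) (sum-cong-≗ λ i →
  cong ⟦_⟧ (trans (lookup-zipWith _∧_ i p (∁ q)) (cong (lookup p i ∧_) (lookup-map i not q))))

∣p∩∁q∣+∣p∩q∣≡∣p∣ : ∀ {n} (p q : Subset n) → ∣ p ∩ ∁ q ∣ + ∣ p ∩ q ∣ ≡ ∣ p ∣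
∣p∩∁q∣+∣p∩q∣≡∣p∣ []          []          = refl
∣p∩∁q∣+∣p∩q∣≡∣p∣ (false ∷ p) (_     ∷ q) = ∣p∩∁q∣+∣p∩q∣≡∣p∣ p q
∣p∩∁q∣+∣p∩q∣≡∣p∣ (true  ∷ p) (false ∷ q) = cong suc (∣p∩∁q∣+∣p∩q∣≡∣p∣ p q)
∣p∩∁q∣+∣p∩q∣≡∣p∣ (true  ∷ p) (true  ∷ q) =
  trans (+-suc ∣ p ∩ ∁ q ∣ ∣ p ∩ q ∣) (cong suc (∣p∩∁q∣+∣p∩q∣≡∣p∣ p q))

x∈p⇒1≤∣p∣ : ∀ {n} {x : Fin n} {p : Subset n} → x ∈ p → 1 ≤ ∣ p ∣
x∈p⇒1≤∣p∣ {x = x} {p} x∈p = subst (_≤ ∣ p ∣) (∣⁅x⁆∣≡1 x)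
  (p⊆q⇒∣p∣≤∣q∣ (λ y∈⁅x⁆ → subst (_∈ p) (sym (x∈⁅y⁆⇒x≡y x y∈⁅x⁆)) x∈p))

∁-nonempty : ∀ {n} (p : Subset n) → 0 < ∣ ∁ p ∣ → ∃ λ e → lookup p e ≡ false
∁-nonempty (false ∷ p) _ = zero , refl
∁-nonempty (true  ∷ p) h with e , pe≡false ← ∁-nonempty p h = suc e , pe≡false

∪-swapʳ : ∀ {n} (F p q : Subset n) → (F ∪ p) ∪ q ≡ (F ∪ q) ∪ p
∪-swapʳ F p q = trans (∪-assoc F p q) (trans (cong (F ∪_) (∪-comm p q)) (sym (∪-assoc F q p)))

disjoint : ∀ {n} → Subset n → Subset n → Bool
disjoint []      []      = true
disjoint (x ∷ p) (y ∷ q) = not (x ∧ y) ∧ disjoint p q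

disjoint-comm : ∀ {n} (p q : Subset n) → disjoint p q ≡ disjoint q p
disjoint-comm []      []      = refl
disjoint-comm (x ∷ p) (y ∷ q) = cong₂ _∧_ (cong not (∧-comm x y)) (disjoint-comm p q)

disjoint-∪ʳ : ∀ {n} (p q q′ : Subset n) → disjoint p (q ∪ q′) ≡ disjoint p q ∧ disjoint p q′
disjoint-∪ʳ []           []           []           = refl
disjoint-∪ʳ (false ∷ p)  (_     ∷ q)  (_     ∷ q′) = disjoint-∪ʳ p q q′
disjoint-∪ʳ (true  ∷ p)  (true  ∷ q)  (_     ∷ q′) = refl
disjoint-∪ʳ (true  ∷ p)  (false ∷ q)  (true  ∷ q′) = sym (∧-zeroʳ (disjoint p q))
disjoint-∪ʳ (true  ∷ p)  (false ∷ q)  (false ∷ q′) = disjoint-∪ʳ p q q′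

disjoint-⊥ʳ : ∀ {n} (p : Subset n) → disjoint p ⊥ ≡ true
disjoint-⊥ʳ []      = refl
disjoint-⊥ʳ (x ∷ p) rewrite ∧-zeroʳ x = disjoint-⊥ʳ p

disjoint-⁅⁆ʳ : ∀ {n} (p : Subset n) e → disjoint p ⁅ e ⁆ ≡ not (lookup p e)
disjoint-⁅⁆ʳ (true  ∷ p) zero    = refl
disjoint-⁅⁆ʳ (false ∷ p) zero    = disjoint-⊥ʳ p
disjoint-⁅⁆ʳ (x     ∷ p) (suc e) rewrite ∧-zeroʳ x = disjoint-⁅⁆ʳ p e

disjoint-common : ∀ {n} (p q : Subset n) e → lookup p e ≡ true → lookup q e ≡ true → disjoint p q ≡ false
disjoint-common (x ∷ p) (y ∷ q) zero    refl refl = refl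
disjoint-common (x ∷ p) (y ∷ q) (suc e) pe qe
  rewrite disjoint-common p q e pe qe = ∧-zeroʳ (not (x ∧ y))

disjoint-self : ∀ {n} (p : Subset n) → disjoint p p ≡ true → ∣ p ∣ ≡ 0
disjoint-self []          _ = refl
disjoint-self (false ∷ p) h = disjoint-self p h

disjoint≡∣∩∣≡ᵇ0 : ∀ {n} (p q : Subset n) → disjoint p q ≡ (∣ p ∩ q ∣ ≡ᵇ 0)
disjoint≡∣∩∣≡ᵇ0 []      []      = refl
disjoint≡∣∩∣≡ᵇ0 (x ∷ p) (y ∷ q) with x ∧ y
... | true  = refl
... | false = disjoint≡∣∩∣≡ᵇ0 p q

disjoint⇒∧≡false : ∀ {n} (p q : Subset n) → disjoint p q ≡ true → ∀ i → lookup p i ∧ lookup q i ≡ false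
disjoint⇒∧≡false (x ∷ p) (y ∷ q) h i with x ∧ y in xy
disjoint⇒∧≡false (x ∷ p) (y ∷ q) h zero    | false = xy
disjoint⇒∧≡false (x ∷ p) (y ∷ q) h (suc i) | false = disjoint⇒∧≡false p q h i

∧≡false⇒disjoint : ∀ {n} (p q : Subset n) → (∀ i → lookup p i ∧ lookup q i ≡ false) → disjoint p q ≡ true
∧≡false⇒disjoint []      []      _ = refl
∧≡false⇒disjoint (x ∷ p) (y ∷ q) h rewrite h zero = ∧≡false⇒disjoint p q (λ i → h (suc i))

∣∁[p∪q]∣+∣q∣≡∣∁p∣ : ∀ {n} (p q : Subset n) → disjoint q p ≡ true → ∣ ∁ (p ∪ q) ∣ + ∣ q ∣ ≡ ∣ ∁ p ∣
∣∁[p∪q]∣+∣q∣≡∣∁p∣ []          []          _ = refl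
∣∁[p∪q]∣+∣q∣≡∣∁p∣ (true  ∷ p) (false ∷ q) h = ∣∁[p∪q]∣+∣q∣≡∣∁p∣ p q h
∣∁[p∪q]∣+∣q∣≡∣∁p∣ (false ∷ p) (false ∷ q) h = cong suc (∣∁[p∪q]∣+∣q∣≡∣∁p∣ p q h)
∣∁[p∪q]∣+∣q∣≡∣∁p∣ (false ∷ p) (true  ∷ q) h =
  trans (+-suc ∣ ∁ (p ∪ q) ∣ ∣ q ∣) (cong suc (∣∁[p∪q]∣+∣q∣≡∣∁p∣ p q h))

admissible : ∀ {n} → Subset n → Subset n → Bool
admissible c F = (∣ c ∣ ≡ᵇ 2) ∧ disjoint c F

admissible-∪ : ∀ {n} (c F G : Subset n) → admissible c (F ∪ G) ≡ admissible c F ∧ disjoint c G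
admissible-∪ c F G rewrite disjoint-∪ʳ c F G = sym (∧-assoc (∣ c ∣ ≡ᵇ 2) (disjoint c F) (disjoint c G))

admissible-intro : ∀ {n} (c F : Subset n) → ∣ c ∣ ≡ 2 → disjoint c F ≡ true → admissible c F ≡ true
admissible-intro c F ∣c∣≡2 c#F rewrite ∣c∣≡2 | c#F = refl

admissible⇒ : ∀ {n} (c F : Subset n) → admissible c F ≡ true → ∣ c ∣ ≡ 2 × disjoint c F ≡ true
admissible⇒ c F h with ∣ c ∣ ≡ᵇ 2 in eq | disjoint c F
... | true | true = ≡ᵇ⇒≡ ∣ c ∣ 2 (subst T (sym eq) _) , refl

admissible-∪⁅⁆ : ∀ {n} (c F : Subset n) e → admissible c (F ∪ ⁅ e ⁆) ≡ admissible c F ∧ not (lookup c e)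
admissible-∪⁅⁆ c F e = trans (admissible-∪ c F ⁅ e ⁆) (cong (admissible c F ∧_) (disjoint-⁅⁆ʳ c e))

admissible-∪-self : ∀ {n} (c F : Subset n) → admissible c F ≡ true → admissible c (F ∪ c) ≡ false
admissible-∪-self c F c-adm with admissible⇒ c F c-adm
... | ∣c∣≡2 , _ rewrite admissible-∪ c F c | c-adm with disjoint c c in c#c
... | false = refl
... | true  with () ← trans (sym (disjoint-self c c#c)) ∣c∣≡2

admissible-∪-common : ∀ {n} (c F c′ : Subset n) e → lookup c e ≡ true → lookup c′ e ≡ true →
                      admissible c (F ∪ c′) ≡ false
admissible-∪-common c F c′ e ce c′e
  rewrite admissible-∪ c F c′ | disjoint-common c c′ e ce c′e = ∧-zeroʳ (admissible c F)

admissible-∪-inadmissible : ∀ {n} (c F G : Subset n) → admissible c F ≡ false → admissible c (F ∪ G) ≡ false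
admissible-∪-inadmissible c F G c-inadm rewrite admissible-∪ c F G | c-inadm = refl

admissible-∪-swap : ∀ {n} (c F c′ : Subset n) → admissible c F ≡ true →
                    admissible c′ (F ∪ c) ≡ admissible c′ F ∧ admissible c (F ∪ c′)
admissible-∪-swap c F c′ c-adm
  rewrite admissible-∪ c′ F c | admissible-∪ c F c′ | c-adm = cong (admissible c′ F ∧_) (disjoint-comm c′ c)

⟦admissible⟧+1≡∣c∩∁F∣ : ∀ {n} (c F : Subset n) e → lookup c e ≡ true → lookup F e ≡ false → ∣ c ∣ ≤ 2 →
                       ⟦ admissible c F ⟧ + 1 ≡ ∣ c ∩ ∁ F ∣
⟦admissible⟧+1≡∣c∩∁F∣ c F e c∋e e∉F ∣c∣≤2
  rewrite disjoint≡∣∩∣≡ᵇ0 c F | sym (∣p∩∁q∣+∣p∩q∣≡∣p∣ c F) =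
  cases ∣ c ∩ ∁ F ∣ ∣ c ∩ F ∣ (x∈p⇒1≤∣p∣ (lookup⇒[]= e (c ∩ ∁ F) e∈c∩∁F)) ∣c∣≤2
  where
  e∈c∩∁F : lookup (c ∩ ∁ F) e ≡ true
  e∈c∩∁F rewrite lookup-zipWith _∧_ e c (∁ F) | lookup-map e not F | c∋e | e∉F = refl
  cases : ∀ a b → 1 ≤ a → a + b ≤ 2 → ⟦ (a + b ≡ᵇ 2) ∧ (b ≡ᵇ 0) ⟧ + 1 ≡ a
  cases 1 0 _ _ = refl
  cases 1 1 _ _ = refl
  cases 2 0 _ _ = refl
  cases 1 (suc (suc b)) _ (s≤s (s≤s ()))
  cases 2 (suc b)       _ (s≤s (s≤s ()))
  cases (suc (suc (suc a))) b _ (s≤s (s≤s ()))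

∣∁[F∪c]∣+2≡∣∁F∣ : ∀ {n} (c F : Subset n) → admissible c F ≡ true → ∣ ∁ (F ∪ c) ∣ + 2 ≡ ∣ ∁ F ∣
∣∁[F∪c]∣+2≡∣∁F∣ c F c-adm with admissible⇒ c F c-adm
... | ∣c∣≡2 , c#F = subst (λ k → ∣ ∁ (F ∪ c) ∣ + k ≡ ∣ ∁ F ∣) ∣c∣≡2 (∣∁[p∪q]∣+∣q∣≡∣∁p∣ F c c#F)

∣∁[F∪⁅e⁆]∣+1≡∣∁F∣ : ∀ {n} (F : Subset n) e → lookup F e ≡ false → ∣ ∁ (F ∪ ⁅ e ⁆) ∣ + 1 ≡ ∣ ∁ F ∣
∣∁[F∪⁅e⁆]∣+1≡∣∁F∣ F e e∉F = subst (λ k → ∣ ∁ (F ∪ ⁅ e ⁆) ∣ + k ≡ ∣ ∁ F ∣) (∣⁅x⁆∣≡1 e)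
  (∣∁[p∪q]∣+∣q∣≡∣∁p∣ F ⁅ e ⁆ (trans (disjoint-comm ⁅ e ⁆ F) (trans (disjoint-⁅⁆ʳ F e) (cong not e∉F))))

-- matchings cs F m counts the sets of m pairwise disjoint two-element columns of cs that
-- are disjoint from F.
mutual
  matchings : ∀ {n r} → (Fin n → Subset r) → Subset r → ℕ → ℕ
  matchings {zero}  cs F zero    = 1
  matchings {zero}  cs F (suc m) = 0
  matchings {suc n} cs F m       = matchings (cs ∘ suc) F m + matchingsUsing (cs zero) (cs ∘ suc) F m

  matchingsUsing : ∀ {n r} → Subset r → (Fin n → Subset r) → Subset r → ℕ → ℕ
  matchingsUsing c cs F zero    = 0
  matchingsUsing c cs F (suc m) = ⟦ admissible c F ⟧ * matchings cs (F ∪ c) m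

matchings-zero : ∀ {n r} (cs : Fin n → Subset r) F → matchings cs F 0 ≡ 1
matchings-zero {zero}  cs F = refl
matchings-zero {suc n} cs F = trans (+-identityʳ _) (matchings-zero (cs ∘ suc) F)

matchings-cong : ∀ {n r} {cs ds : Fin n → Subset r} → (∀ v → cs v ≡ ds v) →
                 ∀ F m → matchings cs F m ≡ matchings ds F m
matchings-cong {zero} cs≡ds F zero    = refl
matchings-cong {zero} cs≡ds F (suc m) = refl
matchings-cong {suc n} {cs = cs} {ds} cs≡ds F m = cong₂ _+_ (matchings-cong (cs≡ds ∘ suc) F m) (head-cong m)
  where
  head-cong : ∀ m → matchingsUsing (cs zero) (cs ∘ suc) F m ≡ matchingsUsing (ds zero) (ds ∘ suc) F m
  head-cong zero    = refl
  head-cong (suc m) rewrite cs≡ds zero =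
    cong (⟦ admissible (ds zero) F ⟧ *_) (matchings-cong (cs≡ds ∘ suc) (F ∪ ds zero) m)

matchingsUsing-inadmissible : ∀ {n r} (c : Subset r) (cs : Fin n → Subset r) F →
                              admissible c F ≡ false → ∀ m → matchingsUsing c cs F m ≡ 0
matchingsUsing-inadmissible c cs F c-inadm zero    = refl
matchingsUsing-inadmissible c cs F c-inadm (suc m) rewrite c-inadm = refl

matchings-suc≡0 : ∀ {n r} (cs : Fin n → Subset r) F m → ∣ ∁ F ∣ < 2 → matchings cs F (suc m) ≡ 0
matchings-suc≡0 {zero}  cs F m ∣∁F∣<2 = refl
matchings-suc≡0 {suc n} cs F m ∣∁F∣<2 = cong₂ _+_ (matchings-suc≡0 (cs ∘ suc) F m ∣∁F∣<2) usingHead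
  where
  usingHead : ⟦ admissible (cs zero) F ⟧ * matchings (cs ∘ suc) (F ∪ cs zero) m ≡ 0
  usingHead with admissible (cs zero) F in c-adm
  ... | false = refl
  ... | true  = contradiction (subst (2 ≤_) (∣∁[F∪c]∣+2≡∣∁F∣ (cs zero) F c-adm) (m≤n+m 2 _)) (<⇒≱ ∣∁F∣<2)

-- Independent sets of degree-two vertices as matchings of the columns

edgesAt : ∀ {n r} → Hypergraph n r → Fin n → Subset r
edgesAt E v = tabulate (λ i → lookup (E i) v)

restrict : ∀ {n r} → Hypergraph (suc n) r → Hypergraph n r
restrict E i = tail (E i)

lookup-edgesAt : ∀ {n r} (E : Hypergraph n r) v i → lookup (edgesAt E v) i ≡ lookup (E i) v
lookup-edgesAt E v = lookup∘tabulate (λ i → lookup (E i) v)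

lookup-edgesAt-zero : ∀ {n r} (E : Hypergraph (suc n) r) i → lookup (edgesAt E zero) i ≡ head (E i)
lookup-edgesAt-zero E i = trans (lookup-edgesAt E zero i) (lookup-zero (E i))
  where
  lookup-zero : ∀ {n} (p : Subset (suc n)) → lookup p zero ≡ head p
  lookup-zero (x ∷ p) = refl

edgesAt-restrict : ∀ {n r} (E : Hypergraph (suc n) r) v → edgesAt (restrict E) v ≡ edgesAt E (suc v)
edgesAt-restrict E v = tabulate-cong (λ i → lookup-tail (E i))
  where
  lookup-tail : (p : Subset (suc _)) → lookup (tail p) v ≡ lookup p (suc v)
  lookup-tail (x ∷ p) = refl

does-∈? : ∀ {n} (v : Fin n) p → does (v ∈? p) ≡ lookup p v
does-∈? zero    (true  ∷ p) = refl
does-∈? zero    (false ∷ p) = refl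
does-∈? (suc v) (x     ∷ p) = does-∈? v p

degree≡∣edgesAt∣ : ∀ {n r} (E : Hypergraph n r) v → degree E v ≡ ∣ edgesAt E v ∣
degree≡∣edgesAt∣ {r = r} E v = begin
  degree E v                            ≡⟨ count-tabulate (λ i → v ∈? E i) (λ i → i) ⟩
  ∑[ i < r ] ⟦ does (v ∈? E i) ⟧        ≡⟨ sum-cong-≗ (λ i → cong ⟦_⟧ (does-∈? v (E i))) ⟩
  ∑[ i < r ] ⟦ lookup (E i) v ⟧         ≡⟨ sum-cong-≗ (λ i → cong ⟦_⟧ (lookup-edgesAt E v i)) ⟨
  ∑[ i < r ] ⟦ lookup (edgesAt E v) i ⟧ ≡⟨ ∣p∣≡∑ (edgesAt E v) ⟨
  ∣ edgesAt E v ∣                       ∎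
  where open ≡-Reasoning

degree-restrict : ∀ {n r} (E : Hypergraph (suc n) r) v → degree (restrict E) v ≡ degree E (suc v)
degree-restrict E v = begin
  degree (restrict E) v       ≡⟨ degree≡∣edgesAt∣ (restrict E) v ⟩
  ∣ edgesAt (restrict E) v ∣  ≡⟨ cong ∣_∣ (edgesAt-restrict E v) ⟩
  ∣ edgesAt E (suc v) ∣       ≡⟨ degree≡∣edgesAt∣ E (suc v) ⟨
  degree E (suc v)            ∎
  where open ≡-Reasoning

∣E∩E∣≡∑ : ∀ {n r} (E : Hypergraph n r) i j →
          ∣ E i ∩ E j ∣ ≡ ∑[ v < n ] ⟦ lookup (edgesAt E v) i ∧ lookup (edgesAt E v) j ⟧
∣E∩E∣≡∑ E i j = trans (∣p∣≡∑ (E i ∩ E j)) (sum-cong-≗ λ v → cong ⟦_⟧ (begin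
  lookup (E i ∩ E j) v
    ≡⟨ lookup-zipWith _∧_ v (E i) (E j) ⟩
  lookup (E i) v ∧ lookup (E j) v
    ≡⟨ cong₂ _∧_ (lookup-edgesAt E v i) (lookup-edgesAt E v j) ⟨
  lookup (edgesAt E v) i ∧ lookup (edgesAt E v) j
    ∎))
  where open ≡-Reasoning

-- The summand ⟦ lookup F i ⟧ forbids S to meet the edges of F.
IndepAvoiding : ∀ {n r} → Hypergraph n r → Subset r → ℕ → Subset n → Set
IndepAvoiding E F m S =
  (∣ S ∣ ≡ m) × ((∀ v → v ∈ S → degree E v ≡ 2) × (∀ i → ⟦ lookup F i ⟧ + ∣ S ∩ E i ∣ ≤ 1))

indepAvoiding? : ∀ {n r} (E : Hypergraph n r) F m → Decidable (IndepAvoiding E F m)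
indepAvoiding? E F m S =
  (∣ S ∣ ≟ m) ×-dec
    (all? (λ v → (v ∈? S) →-dec (degree E v ≟ 2)) ×-dec
     all? (λ i → ⟦ lookup F i ⟧ + ∣ S ∩ E i ∣ ≤? 1))

numIndepAvoiding : ∀ {n r} → Hypergraph n r → Subset r → ℕ → ℕ
numIndepAvoiding {n} E F m = length (filter (indepAvoiding? E F m) (allSubsets n))

⟦f⟧+[⟦a⟧+x]≤1⇔ : ∀ a f x → (⟦ f ⟧ + (⟦ a ⟧ + x) ≤ 1) ⇔ (a ∧ f ≡ false × ⟦ f ∨ a ⟧ + x ≤ 1)
⟦f⟧+[⟦a⟧+x]≤1⇔ a f x = mk⇔ (to a f) (from a f)
  where
  to : ∀ a f → ⟦ f ⟧ + (⟦ a ⟧ + x) ≤ 1 → a ∧ f ≡ false × ⟦ f ∨ a ⟧ + x ≤ 1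
  to false false h       = refl , h
  to false true  h       = refl , h
  to true  false h       = refl , h
  to true  true  (s≤s ())
  from : ∀ a f → a ∧ f ≡ false × ⟦ f ∨ a ⟧ + x ≤ 1 → ⟦ f ⟧ + (⟦ a ⟧ + x) ≤ 1
  from false false (_ , h) = h
  from false true  (_ , h) = h
  from true  false (_ , h) = h

module _ {n r} (E : Hypergraph (suc n) r) (F : Subset r) where

  outside-≐ : ∀ m → (λ S → IndepAvoiding E F m (outside ∷ S)) ≐ IndepAvoiding (restrict E) F m
  outside-≐ m = to , from
    where
    to : ∀ {S} → IndepAvoiding E F m (outside ∷ S) → IndepAvoiding (restrict E) F m S
    to {S} (size , deg , edge) =
      size ,
      (λ v v∈S → trans (degree-restrict E v) (deg (suc v) (there v∈S))) ,
      (λ i → subst (λ x → ⟦ lookup F i ⟧ + x ≤ 1) (∣x∷p∩q∣ outside S (E i)) (edge i))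
    from : ∀ {S} → IndepAvoiding (restrict E) F m S → IndepAvoiding E F m (outside ∷ S)
    from {S} (size , deg , edge) =
      size ,
      (λ { (suc v) (there v∈S) → trans (sym (degree-restrict E v)) (deg v v∈S) }) ,
      (λ i → subst (λ x → ⟦ lookup F i ⟧ + x ≤ 1) (sym (∣x∷p∩q∣ outside S (E i))) (edge i))

  private
    c : Subset r
    c = edgesAt E zero

  inside-edge : ∀ S i → (⟦ lookup F i ⟧ + ∣ (inside ∷ S) ∩ E i ∣ ≤ 1) ⇔
                        (lookup c i ∧ lookup F i ≡ false × ⟦ lookup (F ∪ c) i ⟧ + ∣ S ∩ restrict E i ∣ ≤ 1)
  inside-edge S i
    rewrite ∣x∷p∩q∣ inside S (E i) | lookup-zipWith _∨_ i F c | lookup-edgesAt-zero E i =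
    ⟦f⟧+[⟦a⟧+x]≤1⇔ (head (E i)) (lookup F i) ∣ S ∩ tail (E i) ∣

  inside-admissible : ∀ {m S} → IndepAvoiding E F (suc m) (inside ∷ S) → admissible c F ≡ true
  inside-admissible {S = S} (_ , deg , edge) =
    admissible-intro c F (trans (sym (degree≡∣edgesAt∣ E zero)) (deg zero here))
      (∧≡false⇒disjoint c F (λ i → proj₁ (Equivalence.to (inside-edge S i) (edge i))))

  inside-≐ : admissible c F ≡ true → ∀ m →
             (λ S → IndepAvoiding E F (suc m) (inside ∷ S)) ≐ IndepAvoiding (restrict E) (F ∪ c) m
  inside-≐ c-adm m = to , from
    where
    to : ∀ {S} → IndepAvoiding E F (suc m) (inside ∷ S) → IndepAvoiding (restrict E) (F ∪ c) m S
    to {S} (size , deg , edge) =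
      suc-injective size ,
      (λ v v∈S → trans (degree-restrict E v) (deg (suc v) (there v∈S))) ,
      (λ i → proj₂ (Equivalence.to (inside-edge S i) (edge i)))
    from : ∀ {S} → IndepAvoiding (restrict E) (F ∪ c) m S → IndepAvoiding E F (suc m) (inside ∷ S)
    from {S} (size , deg , edge) =
      cong suc size ,
      (λ { zero here → trans (degree≡∣edgesAt∣ E zero) (proj₁ (admissible⇒ c F c-adm))
         ; (suc v) (there v∈S) → trans (sym (degree-restrict E v)) (deg v v∈S) }) ,
      (λ i → Equivalence.from (inside-edge S i)
               (disjoint⇒∧≡false c F (proj₂ (admissible⇒ c F c-adm)) i , edge i))

numIndepAvoiding≡matchings : ∀ {n r} (E : Hypergraph n r) F m →
                             numIndepAvoiding E F m ≡ matchings (edgesAt E) F m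
numIndepAvoiding≡matchings {zero} E F zero =
  cong length (filter-accept (indepAvoiding? E F zero) {[]} {[]}
                             (refl , (λ _ ()) , λ i → edge (lookup F i) (E i)))
  where
  edge : ∀ b (p : Subset 0) → ⟦ b ⟧ + ∣ [] ∩ p ∣ ≤ 1
  edge true  [] = s≤s z≤n
  edge false [] = z≤n
numIndepAvoiding≡matchings {zero} E F (suc m) =
  cong length (filter-none (indepAvoiding? E F (suc m)) {allSubsets 0} (universal (λ { [] (() , _) }) _))
numIndepAvoiding≡matchings {suc n} E F m = begin
  length (filter P? (map (outside ∷_) L ++ map (inside ∷_) L))
    ≡⟨ length-filter-++ P? (map (outside ∷_) L) _ ⟩
  length (filter P? (map (outside ∷_) L)) + length (filter P? (map (inside ∷_) L))
    ≡⟨ cong₂ _+_ (length-filter-map P? (outside ∷_) L) (length-filter-map P? (inside ∷_) L) ⟩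
  length (filter (P? ∘ (outside ∷_)) L) + length (filter (P? ∘ (inside ∷_)) L)
    ≡⟨ cong₂ _+_ withoutFirst (withFirst m) ⟩
  matchings ds F m + matchingsUsing c ds F m
    ∎
  where
  open ≡-Reasoning
  P? = indepAvoiding? E F m
  L  = allSubsets n
  c  = edgesAt E zero
  ds = edgesAt E ∘ suc
  countRestrict : ∀ F′ m′ → length (filter (indepAvoiding? (restrict E) F′ m′) L) ≡ matchings ds F′ m′
  countRestrict F′ m′ =
    trans (numIndepAvoiding≡matchings (restrict E) F′ m′) (matchings-cong (edgesAt-restrict E) F′ m′)
  withoutFirst : length (filter (P? ∘ (outside ∷_)) L) ≡ matchings ds F m
  withoutFirst = trans (cong length (filter-≐ _ _ (outside-≐ E F m) L)) (countRestrict F m)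
  withFirst : ∀ m → length (filter (indepAvoiding? E F m ∘ (inside ∷_)) L) ≡ matchingsUsing c ds F m
  withFirst zero    = cong length (filter-none _ (universal (λ S → λ { (() , _) }) L))
  withFirst (suc m) with admissible c F in c-adm
  ... | true  = trans (cong length (filter-≐ _ _ (inside-≐ E F c-adm m) L))
                      (trans (countRestrict (F ∪ c) m) (sym (+-identityʳ _)))
  ... | false = cong length (filter-none _ (universal rejected L))
    where
    rejected : ∀ S → ¬ IndepAvoiding E F (suc m) (inside ∷ S)
    rejected S p = contradiction (trans (sym (inside-admissible E F p)) c-adm) λ ()

IsIndepDeg2≐IndepAvoiding⊥ : ∀ {n r} (E : Hypergraph n r) m → IsIndepDeg2 E m ≐ IndepAvoiding E ⊥ m
IsIndepDeg2≐IndepAvoiding⊥ E m =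
  (λ (size , deg , edge) → size , deg , λ i → subst (λ b → ⟦ b ⟧ + _ ≤ 1) (sym (⊥-lookup i)) (edge i)) ,
  (λ (size , deg , edge) → size , deg , λ i → subst (λ b → ⟦ b ⟧ + _ ≤ 1) (⊥-lookup i) (edge i))
  where
  ⊥-lookup : ∀ i → lookup ⊥ i ≡ false
  ⊥-lookup i = lookup-replicate i false

-- Counting matchings by a free edge

through : ∀ {n r} → (Fin n → Subset r) → Fin r → Subset r → Fin n → Bool
through cs e F v = lookup (cs v) e ∧ admissible (cs v) F

∑through*matchingsUsing≡0 : ∀ {n r} (c : Subset r) (ds : Fin n → Subset r) e F m →
                            (∀ v → lookup (ds v) e ≡ true → admissible c (F ∪ ds v) ≡ false) →
                            ∑[ v < n ] (⟦ through ds e F v ⟧ * matchingsUsing c ds (F ∪ ds v) m) ≡ 0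
∑through*matchingsUsing≡0 c ds e F m inadmissible = ∑-zero term
  where
  term : ∀ v → ⟦ through ds e F v ⟧ * matchingsUsing c ds (F ∪ ds v) m ≡ 0
  term v with lookup (ds v) e in dv∋e
  ... | false = refl
  ... | true  = trans (cong (⟦ admissible (ds v) F ⟧ *_)
                            (matchingsUsing-inadmissible c ds (F ∪ ds v) (inadmissible v dv∋e) m))
                      (*-zeroʳ ⟦ admissible (ds v) F ⟧)

-- The free edge e is either left unmatched or matched by a column through it.
mutual
  matchings-split : ∀ {n r} (cs : Fin n → Subset r) e F m → lookup F e ≡ false →
                    matchings cs F (suc m) ≡
                    matchings cs (F ∪ ⁅ e ⁆) (suc m) +
                    ∑[ v < n ] (⟦ through cs e F v ⟧ * matchings cs (F ∪ cs v) m)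
  matchings-split {zero}  cs e F m e∉F = refl
  matchings-split {suc n} cs e F m e∉F = begin
    M F (suc m) + ⟦ admissible c F ⟧ * M (F ∪ c) m
      ≡⟨ cong₂ _+_ (matchings-split ds e F m e∉F) (matchingsUsing-split c ds e F m e∉F) ⟩
    M (F ∪ ⁅ e ⁆) (suc m) + R + (A + B + W)
      ≡⟨ rearrange (M (F ∪ ⁅ e ⁆) (suc m)) R A B W ⟩
    M (F ∪ ⁅ e ⁆) (suc m) + A + (B + (R + W))
      ≡⟨ cong (λ x → M (F ∪ ⁅ e ⁆) (suc m) + A + (B + x)) splitTail ⟨
    M (F ∪ ⁅ e ⁆) (suc m) + A + (B + ∑[ v < n ] (⟦ through ds e F v ⟧ * matchings cs (F ∪ ds v) m))
      ∎
    where
    open ≡-Reasoning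
    ds = cs ∘ suc
    c  = cs zero
    M  = matchings ds
    R  = ∑[ v < n ] (⟦ through ds e F v ⟧ * M (F ∪ ds v) m)
    W  = ∑[ v < n ] (⟦ through ds e F v ⟧ * matchingsUsing c ds (F ∪ ds v) m)
    A  = ⟦ admissible c (F ∪ ⁅ e ⁆) ⟧ * M ((F ∪ ⁅ e ⁆) ∪ c) m
    B  = ⟦ through cs e F zero ⟧ * matchings cs (F ∪ c) m
    rearrange : ∀ a t x y w → a + t + (x + y + w) ≡ a + x + (y + (t + w))
    rearrange = solve-∀
    splitTail : ∑[ v < n ] (⟦ through ds e F v ⟧ * matchings cs (F ∪ ds v) m) ≡ R + W
    splitTail = trans (sum-cong-≗ (λ v → *-distribˡ-+ ⟦ through ds e F v ⟧ _ _))
                      (∑-distrib-+ (λ v → ⟦ through ds e F v ⟧ * M (F ∪ ds v) m) _)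

  -- The matchings using c, according to whether e is unmatched, matched by c, or matched by
  -- a later column.
  matchingsUsing-split : ∀ {n r} (c : Subset r) (ds : Fin n → Subset r) e F m → lookup F e ≡ false →
    ⟦ admissible c F ⟧ * matchings ds (F ∪ c) m ≡
    ⟦ admissible c (F ∪ ⁅ e ⁆) ⟧ * matchings ds ((F ∪ ⁅ e ⁆) ∪ c) m +
    ⟦ lookup c e ∧ admissible c F ⟧ * (matchings ds (F ∪ c) m + matchingsUsing c ds (F ∪ c) m) +
    ∑[ v < n ] (⟦ through ds e F v ⟧ * matchingsUsing c ds (F ∪ ds v) m)
  matchingsUsing-split c ds e F m e∉F
    rewrite admissible-∪⁅⁆ c F e with admissible c F in c-adm | lookup c e in ce
  ... | false | true  =
    sym (∑through*matchingsUsing≡0 c ds e F m (λ v _ → admissible-∪-inadmissible c F (ds v) c-adm))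
  ... | false | false =
    sym (∑through*matchingsUsing≡0 c ds e F m (λ v _ → admissible-∪-inadmissible c F (ds v) c-adm))
  ... | true  | true  = sym (begin
    M (F ∪ c) m + matchingsUsing c ds (F ∪ c) m + 0 + W
      ≡⟨ cong₂ (λ u w → M (F ∪ c) m + u + 0 + w)
               (matchingsUsing-inadmissible c ds (F ∪ c) (admissible-∪-self c F c-adm) m)
               (∑through*matchingsUsing≡0 c ds e F m
                 (λ v dv∋e → admissible-∪-common c F (ds v) e ce dv∋e)) ⟩
    M (F ∪ c) m + 0 + 0 + 0
      ≡⟨ trans (+-identityʳ _) (+-identityʳ _) ⟩
    M (F ∪ c) m + 0
      ∎)
    where
    open ≡-Reasoning
    M = matchings ds
    W = ∑[ v < _ ] (⟦ through ds e F v ⟧ * matchingsUsing c ds (F ∪ ds v) m)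
  ... | true  | false = trans (cong (_+ 0) (matchings-split-∪ c ds e F c-adm ce e∉F m))
                              (shuffle (matchings ds ((F ∪ ⁅ e ⁆) ∪ c) m) W)
    where
    W = ∑[ v < _ ] (⟦ through ds e F v ⟧ * matchingsUsing c ds (F ∪ ds v) m)
    shuffle : ∀ a w → a + w + 0 ≡ a + 0 + 0 + w
    shuffle = solve-∀

  matchings-split-∪ : ∀ {n r} (c : Subset r) (ds : Fin n → Subset r) e F →
    admissible c F ≡ true → lookup c e ≡ false → lookup F e ≡ false → ∀ m →
    matchings ds (F ∪ c) m ≡
    matchings ds ((F ∪ ⁅ e ⁆) ∪ c) m + ∑[ v < n ] (⟦ through ds e F v ⟧ * matchingsUsing c ds (F ∪ ds v) m)
  matchings-split-∪ {n} c ds e F c-adm ce e∉F zero = begin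
    matchings ds (F ∪ c) 0
      ≡⟨ matchings-zero ds (F ∪ c) ⟩
    1
      ≡⟨ cong₂ _+_ (matchings-zero ds ((F ∪ ⁅ e ⁆) ∪ c)) (∑-zero (λ v → *-zeroʳ ⟦ through ds e F v ⟧)) ⟨
    matchings ds ((F ∪ ⁅ e ⁆) ∪ c) 0 + ∑[ v < n ] (⟦ through ds e F v ⟧ * 0)
      ∎
    where open ≡-Reasoning
  matchings-split-∪ {n} c ds e F c-adm ce e∉F (suc m) = begin
    M (F ∪ c) (suc m)
      ≡⟨ matchings-split ds e (F ∪ c) m e∉F∪c ⟩
    M ((F ∪ c) ∪ ⁅ e ⁆) (suc m) + ∑[ v < n ] (⟦ through ds e (F ∪ c) v ⟧ * M ((F ∪ c) ∪ ds v) m)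
      ≡⟨ cong₂ _+_ (cong (λ X → M X (suc m)) (∪-swapʳ F c ⁅ e ⁆)) (sum-cong-≗ term) ⟩
    M ((F ∪ ⁅ e ⁆) ∪ c) (suc m) +
    ∑[ v < n ] (⟦ through ds e F v ⟧ * (⟦ admissible c (F ∪ ds v) ⟧ * M ((F ∪ ds v) ∪ c) m))
      ∎
    where
    open ≡-Reasoning
    M = matchings ds
    e∉F∪c : lookup (F ∪ c) e ≡ false
    e∉F∪c rewrite lookup-zipWith _∨_ e F c | e∉F | ce = refl
    term : ∀ v → ⟦ through ds e (F ∪ c) v ⟧ * M ((F ∪ c) ∪ ds v) m ≡
                 ⟦ through ds e F v ⟧ * (⟦ admissible c (F ∪ ds v) ⟧ * M ((F ∪ ds v) ∪ c) m)
    term v rewrite admissible-∪-swap c F (ds v) c-adm | ∪-swapʳ F c (ds v) =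
      trans (cong (λ b → ⟦ b ⟧ * M ((F ∪ ds v) ∪ c) m)
                  (sym (∧-assoc (lookup (ds v) e) (admissible (ds v) F) (admissible c (F ∪ ds v)))))
            (⟦⟧*-∧ (through ds e F v) (admissible c (F ∪ ds v)) _)

multiplicity : ∀ {n r} → (Fin n → Subset r) → Fin r → Fin r → ℕ
multiplicity {n} cs i j = ∑[ v < n ] ⟦ lookup (cs v) i ∧ lookup (cs v) j ⟧

∑⟦e∈cs⟧∣cs∩∁F∣≡∑multiplicity : ∀ {n r} (cs : Fin n → Subset r) e F →
  ∑[ v < n ] (⟦ lookup (cs v) e ⟧ * ∣ cs v ∩ ∁ F ∣) ≡
              ∑[ j < r ] (multiplicity cs e j * ⟦ not (lookup F j) ⟧)
∑⟦e∈cs⟧∣cs∩∁F∣≡∑multiplicity {n} {r} cs e F = begin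
  ∑[ v < n ] (⟦ lookup (cs v) e ⟧ * ∣ cs v ∩ ∁ F ∣)
    ≡⟨ sum-cong-≗ (λ v → trans (cong (⟦ lookup (cs v) e ⟧ *_) (∣p∩∁q∣≡∑ (cs v) F))
                               (*-distribˡ-sum ⟦ lookup (cs v) e ⟧ λ j → ⟦ lookup (cs v) j ∧ not (lookup F j) ⟧)) ⟩
  ∑[ v < n ] ∑[ j < r ] (⟦ lookup (cs v) e ⟧ * ⟦ lookup (cs v) j ∧ not (lookup F j) ⟧)
    ≡⟨ sum-cong-≗ (λ v → sum-cong-≗ (λ j → ⟦a⟧*⟦b∧c⟧≡⟦a∧b⟧*⟦c⟧ (lookup (cs v) e) (lookup (cs v) j) _)) ⟩
  ∑[ v < n ] ∑[ j < r ] (⟦ lookup (cs v) e ∧ lookup (cs v) j ⟧ * ⟦ not (lookup F j) ⟧)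
    ≡⟨ ∑-comm (λ v j → ⟦ lookup (cs v) e ∧ lookup (cs v) j ⟧ * ⟦ not (lookup F j) ⟧) ⟩
  ∑[ j < r ] ∑[ v < n ] (⟦ lookup (cs v) e ∧ lookup (cs v) j ⟧ * ⟦ not (lookup F j) ⟧)
    ≡⟨ sum-cong-≗ (λ j → *-distribʳ-sum ⟦ not (lookup F j) ⟧ λ v → ⟦ lookup (cs v) e ∧ lookup (cs v) j ⟧) ⟨
  ∑[ j < r ] (multiplicity cs e j * ⟦ not (lookup F j) ⟧)
    ∎
  where open ≡-Reasoning

-- Matchings of complete graphs

-- Matchings of m edges in the complete graph on s vertices: the last vertex is either
-- unmatched or matched to one of the others.
completeMatchings : ℕ → ℕ → ℕ
completeMatchings _             zero    = 1
completeMatchings zero          (suc m) = 0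
completeMatchings (suc zero)    (suc m) = 0
completeMatchings (suc (suc s)) (suc m) = completeMatchings (suc s) (suc m) + suc s * completeMatchings s m

module _ {n r} (cs : Fin n → Subset r) (∣cs∣≤2 : ∀ v → ∣ cs v ∣ ≤ 2)
         (pairsOnce : ∀ i j → i ≢ j → multiplicity cs i j ≡ 1) where

  -- The admissible columns through e join e to each other free edge exactly once. Both
  -- sides are increased by the number of columns through e so that nothing is subtracted.
  ∑through+1≡∣∁F∣ : ∀ e F → lookup F e ≡ false → ∑[ v < n ] ⟦ through cs e F v ⟧ + 1 ≡ ∣ ∁ F ∣
  ∑through+1≡∣∁F∣ e F e∉F = +-cancelʳ-≡ (multiplicity cs e e) _ _ (begin
    ∑[ v < n ] ⟦ through cs e F v ⟧ + 1 + multiplicity cs e e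
      ≡⟨ shuffle _ (multiplicity cs e e) ⟩
    ∑[ v < n ] ⟦ through cs e F v ⟧ + multiplicity cs e e + 1
      ≡⟨ cong (∑[ v < n ] ⟦ through cs e F v ⟧ + multiplicity cs e e +_) ⟦¬Fe⟧≡1 ⟨
    ∑[ v < n ] ⟦ through cs e F v ⟧ + multiplicity cs e e + ⟦ not (lookup F e) ⟧
      ≡⟨ cong (_+ ⟦ not (lookup F e) ⟧)
              (trans (sym (∑-distrib-+ (λ v → ⟦ through cs e F v ⟧) _)) (sum-cong-≗ perColumn)) ⟩
    ∑[ v < n ] (⟦ lookup (cs v) e ⟧ * ∣ cs v ∩ ∁ F ∣) + ⟦ not (lookup F e) ⟧
      ≡⟨ cong (_+ ⟦ not (lookup F e) ⟧) (∑⟦e∈cs⟧∣cs∩∁F∣≡∑multiplicity cs e F) ⟩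
    ∑[ j < r ] (multiplicity cs e j * ⟦ not (lookup F j) ⟧) + ⟦ not (lookup F e) ⟧
      ≡⟨ ∑-exchange _ _ e (λ j j≢e → trans (cong (_* ⟦ not (lookup F j) ⟧) (pairsOnce e j (j≢e ∘ sym)))
                                            (*-identityˡ _)) ⟩
    ∑[ j < r ] ⟦ not (lookup F j) ⟧ + multiplicity cs e e * ⟦ not (lookup F e) ⟧
      ≡⟨ cong₂ _+_ (∣∁p∣≡∑ F) (sym (trans (cong (multiplicity cs e e *_) ⟦¬Fe⟧≡1) (*-identityʳ _))) ⟨
    ∣ ∁ F ∣ + multiplicity cs e e
      ∎)
    where
    open ≡-Reasoning
    shuffle : ∀ a d → a + 1 + d ≡ a + d + 1
    shuffle = solve-∀
    ⟦¬Fe⟧≡1 : ⟦ not (lookup F e) ⟧ ≡ 1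
    ⟦¬Fe⟧≡1 = cong (⟦_⟧ ∘ not) e∉F
    perColumn : ∀ v → ⟦ through cs e F v ⟧ + ⟦ lookup (cs v) e ∧ lookup (cs v) e ⟧ ≡
                      ⟦ lookup (cs v) e ⟧ * ∣ cs v ∩ ∁ F ∣
    perColumn v with lookup (cs v) e in c∋e
    ... | true  = trans (⟦admissible⟧+1≡∣c∩∁F∣ (cs v) F e c∋e e∉F (∣cs∣≤2 v)) (sym (+-identityʳ _))
    ... | false = refl

  matchings≡completeMatchings : ∀ s F m → ∣ ∁ F ∣ ≡ s → matchings cs F m ≡ completeMatchings s m
  matchings≡completeMatchings s F zero _ = matchings-zero cs F
  matchings≡completeMatchings zero F (suc m) ∣∁F∣≡0 =
    matchings-suc≡0 cs F m (subst (_< 2) (sym ∣∁F∣≡0) (s≤s z≤n))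
  matchings≡completeMatchings (suc zero) F (suc m) ∣∁F∣≡1 =
    matchings-suc≡0 cs F m (subst (_< 2) (sym ∣∁F∣≡1) ≤-refl)
  matchings≡completeMatchings (suc (suc s)) F (suc m) ∣∁F∣≡2+s = begin
    matchings cs F (suc m)
      ≡⟨ matchings-split cs e F m e∉F ⟩
    matchings cs (F ∪ ⁅ e ⁆) (suc m) + ∑[ v < n ] (⟦ through cs e F v ⟧ * matchings cs (F ∪ cs v) m)
      ≡⟨ cong₂ _+_ (matchings≡completeMatchings (suc s) (F ∪ ⁅ e ⁆) (suc m) ∣∁[F∪⁅e⁆]∣≡1+s)
                   (sum-cong-≗ term) ⟩
    completeMatchings (suc s) (suc m) + ∑[ v < n ] (⟦ through cs e F v ⟧ * completeMatchings s m)
      ≡⟨ cong (completeMatchings (suc s) (suc m) +_)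
              (*-distribʳ-sum (completeMatchings s m) λ v → ⟦ through cs e F v ⟧) ⟨
    completeMatchings (suc s) (suc m) + ∑[ v < n ] ⟦ through cs e F v ⟧ * completeMatchings s m
      ≡⟨ cong (λ k → completeMatchings (suc s) (suc m) + k * completeMatchings s m) ∑through≡1+s ⟩
    completeMatchings (suc s) (suc m) + suc s * completeMatchings s m
      ∎
    where
    open ≡-Reasoning
    freeEdge : ∃ λ e → lookup F e ≡ false
    freeEdge = ∁-nonempty F (subst (0 <_) (sym ∣∁F∣≡2+s) (s≤s z≤n))
    e = proj₁ freeEdge
    e∉F = proj₂ freeEdge
    ∣∁F∣≡1+s+1 : ∣ ∁ F ∣ ≡ suc s + 1
    ∣∁F∣≡1+s+1 = trans ∣∁F∣≡2+s (+-comm 1 (suc s))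
    ∣∁[F∪⁅e⁆]∣≡1+s : ∣ ∁ (F ∪ ⁅ e ⁆) ∣ ≡ suc s
    ∣∁[F∪⁅e⁆]∣≡1+s = +-cancelʳ-≡ 1 _ _ (trans (∣∁[F∪⁅e⁆]∣+1≡∣∁F∣ F e e∉F) ∣∁F∣≡1+s+1)
    ∑through≡1+s : ∑[ v < n ] ⟦ through cs e F v ⟧ ≡ suc s
    ∑through≡1+s = +-cancelʳ-≡ 1 _ _ (trans (∑through+1≡∣∁F∣ e F e∉F) ∣∁F∣≡1+s+1)
    term : ∀ v → ⟦ through cs e F v ⟧ * matchings cs (F ∪ cs v) m ≡
                 ⟦ through cs e F v ⟧ * completeMatchings s m
    term v with lookup (cs v) e | admissible (cs v) F in c-adm
    ... | false | _     = refl
    ... | true  | false = refl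
    ... | true  | true  = cong (_+ 0) (matchings≡completeMatchings s (F ∪ cs v) m
      (+-cancelʳ-≡ 2 _ _ (trans (∣∁[F∪c]∣+2≡∣∁F∣ (cs v) F c-adm) (trans ∣∁F∣≡2+s (+-comm 2 s)))))

completeMatchings-vanishes : ∀ s m → s < 2 * m → completeMatchings s m ≡ 0
completeMatchings-vanishes zero          (suc m) _ = refl
completeMatchings-vanishes (suc zero)    (suc m) _ = refl
completeMatchings-vanishes (suc (suc s)) (suc m) s+2<2[m+1] = cong₂ _+_
  (completeMatchings-vanishes (suc s) (suc m) (<-trans (n<1+n (suc s)) s+2<2[m+1]))
  (trans (cong (suc s *_) (completeMatchings-vanishes s m s<2m)) (*-zeroʳ (suc s)))
  where
  s<2m : s < 2 * m
  s<2m = +-cancelˡ-< 2 s (2 * m) (subst (suc (suc s) <_) (*-distribˡ-+ 2 1 m) s+2<2[m+1])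

-- Stated for s = 2 m + t, which avoids the truncated subtraction s ∸ 2 m.
completeMatchings-closed : ∀ m t → completeMatchings (2 * m + t) m * (t ! * m ! * 2 ^ m) ≡ (2 * m + t) !
completeMatchings-closed zero    t = 1*[x*1*1]≡x (t !)
  where
  1*[x*1*1]≡x : ∀ x → 1 * (x * 1 * 1) ≡ x
  1*[x*1*1]≡x = solve-∀
completeMatchings-closed (suc m) t =
  subst (λ s → completeMatchings s (suc m) * (t ! * suc m ! * 2 ^ suc m) ≡ s !)
        (sym (2[1+m]+t m t)) (step t)
  where
  open ≡-Reasoning
  2[1+m]+t : ∀ m t → 2 * suc m + t ≡ suc (suc (2 * m + t))
  2[1+m]+t = solve-∀
  step : ∀ t → completeMatchings (suc (suc (2 * m + t))) (suc m) * (t ! * suc m ! * 2 ^ suc m) ≡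
               suc (suc (2 * m + t)) !
  step zero = begin
    (completeMatchings (suc a) (suc m) + suc a * completeMatchings a m) * (1 * (suc m * m !) * (2 * 2 ^ m))
      ≡⟨ cong (λ k → (k + suc a * completeMatchings a m) * (1 * (suc m * m !) * (2 * 2 ^ m)))
              (completeMatchings-vanishes (suc a) (suc m) 1+a<2[1+m]) ⟩
    (0 + suc a * completeMatchings a m) * (1 * (suc m * m !) * (2 * 2 ^ m))
      ≡⟨ regroup m (completeMatchings a m) (m !) (2 ^ m) ⟩
    suc a * (2 * suc m) * (completeMatchings a m * (1 * m ! * 2 ^ m))
      ≡⟨ cong (suc a * (2 * suc m) *_) (completeMatchings-closed m 0) ⟩
    suc a * (2 * suc m) * a !
      ≡⟨ finish m (a !) ⟩
    suc (suc a) * (suc a * a !)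
      ∎
    where
    a = 2 * m + 0
    1+a<2[1+m] : suc a < 2 * suc m
    1+a<2[1+m] = subst (suc a <_) (trans (sym (2[1+m]+t m 0)) (+-identityʳ _)) (n<1+n (suc a))
    regroup : ∀ m k f p → (0 + suc (2 * m + 0) * k) * (1 * (suc m * f) * (2 * p)) ≡
                          suc (2 * m + 0) * (2 * suc m) * (k * (1 * f * p))
    regroup = solve-∀
    finish : ∀ m f → suc (2 * m + 0) * (2 * suc m) * f ≡ suc (suc (2 * m + 0)) * (suc (2 * m + 0) * f)
    finish = solve-∀
  step (suc t) = begin
    (completeMatchings (suc a) (suc m) + suc a * completeMatchings a m) *
    (suc t * t ! * (suc m * m !) * (2 * 2 ^ m))
      ≡⟨ regroup a m t (completeMatchings (suc a) (suc m)) (completeMatchings a m) (t !) (m !) (2 ^ m) ⟩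
    suc t * (completeMatchings (suc a) (suc m) * (t ! * (suc m * m !) * (2 * 2 ^ m))) +
    suc a * (2 * suc m) * (completeMatchings a m * (suc t * t ! * m ! * 2 ^ m))
      ≡⟨ cong₂ (λ x y → suc t * x + suc a * (2 * suc m) * y)
               fewerFree (completeMatchings-closed m (suc t)) ⟩
    suc t * (suc a * a !) + suc a * (2 * suc m) * a !
      ≡⟨ finish m t (a !) ⟩
    suc (suc a) * (suc a * a !)
      ∎
    where
    a = 2 * m + suc t
    fewerFree : completeMatchings (suc a) (suc m) * (t ! * (suc m * m !) * (2 * 2 ^ m)) ≡ suc a * a !
    fewerFree = subst (λ s → completeMatchings s (suc m) * (t ! * (suc m * m !) * (2 * 2 ^ m)) ≡ s !)
                      (trans (2[1+m]+t m t) (cong suc (sym (+-suc (2 * m) t))))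
                      (completeMatchings-closed (suc m) t)
    regroup : ∀ a m t x y f g p → (x + suc a * y) * (suc t * f * (suc m * g) * (2 * p)) ≡
              suc t * (x * (f * (suc m * g) * (2 * p))) + suc a * (2 * suc m) * (y * (suc t * f * g * p))
    regroup = solve-∀
    finish : ∀ m t f → let a = 2 * m + suc t in
             suc t * (suc a * f) + suc a * (2 * suc m) * f ≡ suc (suc a) * (suc a * f)
    finish = solve-∀

formula≡completeMatchings : ∀ r m → 2 * m ≤ r → formula r m ≡ completeMatchings r m
formula≡completeMatchings r m 2m≤r =
  trans (cong (λ x → _/_ x D {{D≢0}}) (sym K*D≡r!)) (m*n/n≡m (completeMatchings r m) D {{D≢0}})
  where
  D = (r ∸ 2 * m) ! * m ! * 2 ^ m
  D≢0 : NonZero D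
  D≢0 = m*n≢0 ((r ∸ 2 * m) ! * m !) (2 ^ m)
          {{m*n≢0 ((r ∸ 2 * m) !) (m !) {{(r ∸ 2 * m) !≢0}} {{m !≢0}}}} {{m^n≢0 2 m}}
  K*D≡r! : completeMatchings r m * D ≡ r !
  K*D≡r! = subst (λ s → completeMatchings s m * D ≡ s !) (m+[n∸m]≡n 2m≤r)
                 (completeMatchings-closed m (r ∸ 2 * m))

lemma2 : ∀ {n r : ℕ} (k : ℕ) (E : Hypergraph n r) →
    DistinctEdges E → Uniform E k → Simple E → Intersecting E →
    MaxDegree≤ E 2 →
    ∀ (m : ℕ) → 1 ≤ m → 2 * m ≤ r →
    numIndepDeg2 E m ≡ formula r m
lemma2 {n} {r} _ E _ _ simple intersecting maxDegree m _ 2m≤r = begin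
  numIndepDeg2 E m           ≡⟨ cong length (filter-≐ (isIndepDeg2? E m) (indepAvoiding? E ⊥ m)
                                                       (IsIndepDeg2≐IndepAvoiding⊥ E m) (allSubsets n)) ⟩
  numIndepAvoiding E ⊥ m     ≡⟨ numIndepAvoiding≡matchings E ⊥ m ⟩
  matchings (edgesAt E) ⊥ m  ≡⟨ matchings≡completeMatchings (edgesAt E) ∣edgesAt∣≤2 pairsOnce r ⊥ m ∣∁⊥∣≡r ⟩
  completeMatchings r m      ≡⟨ formula≡completeMatchings r m 2m≤r ⟨
  formula r m                ∎
  where
  open ≡-Reasoning
  ∣edgesAt∣≤2 : ∀ v → ∣ edgesAt E v ∣ ≤ 2
  ∣edgesAt∣≤2 v = subst (_≤ 2) (degree≡∣edgesAt∣ E v) (maxDegree v)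
  pairsOnce : ∀ i j → i ≢ j → multiplicity (edgesAt E) i j ≡ 1
  pairsOnce i j i≢j = trans (sym (∣E∩E∣≡∑ E i j))
    (≤-antisym (simple i j i≢j) (x∈p⇒1≤∣p∣ (proj₂ (intersecting i j i≢j))))
  ∣∁⊥∣≡r : ∣ ∁ (⊥ {r}) ∣ ≡ r
  ∣∁⊥∣≡r = trans (∣∁p∣≡n∸∣p∣ (⊥ {r})) (cong (r ∸_) (∣⊥∣≡0 r))
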